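{- Let $G$ be a subcubic graph, $\pi=\{V_1,\dots,V_k\}$ a connected coalition partition of $G$, and $H=CCG(G,\pi)$. If $H$ contains a vertex $V_i$ of degree at least 4, then $V_i$ is a dominating set in $G$ and the induced subgraph $G[V_i]$ is disconnected.
   Context: Graphs are finite and simple. A graph is subcubic if it is connected and its maximum vertex degree is at most 3. $G[S]$ is the induced subgraph. A set $D\subseteq V$ is dominating if every vertex of $V\setminus D$ has a neighbour in $D$; connected dominating if moreover $G[D]$ is connected. Two disjoint subsets $A,B\subseteq V$ form a connected coalition if neither is a connected dominating set but $A\cup B$ is. A connected coalition partition of $G$ is a partition $\pi=\{V_1,\dots,V_k\}$ of $V$ such that each $V_i$ either is a connected dominating set consisting of a single vertex or forms a connected coalition with some set of $\pi$. The coalition graph $CCG(G,\pi)$ has vertex set $\{V_1,\dots,V_k\}$, with $V_i\sim V_j$ iff they form a connected coalition. -}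

module Defs where

open import Data.Nat using (ℕ; zero; suc; _+_; _≤_)
open import Data.Bool using (Bool; true; false; if_then_else_; T)
open import Data.Fin using (Fin)
open import Data.List using (List; map; allFin)
open import Data.Nat.ListAction using (sum)
open import Data.Product using (Σ; ∃; ∃-syntax; _×_; _,_)
open import Data.Sum using (_⊎_)
open import Relation.Binary.PropositionalEquality using (_≡_; _≢_)
open import Relation.Nullary using (¬_)
open import Function.Definitions using (Injective)

record Graph (n : ℕ) : Set where
  field
    adj   : Fin n → Fin n → Bool
    sym   : ∀ u v → adj u v ≡ adj v u
    irrefl : ∀ v → adj v v ≡ false
open Graph public

VSet : ℕ → Set₁
VSet n = Fin n → Set

_∪_ : ∀ {n} → VSet n → VSet n → VSet n
(A ∪ B) v = A v ⊎ B v

degree : ∀ {n} → Graph n → Fin n → ℕ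
degree {n} G v = sum (map (λ u → if adj G v u then 1 else 0) (allFin n))

-- walks inside a vertex set S (i.e. walks in the induced subgraph G[S])
data WalkIn {n} (G : Graph n) (S : VSet n) : Fin n → Fin n → Set where
  here : ∀ {v} → S v → WalkIn G S v v
  step : ∀ {u w v} → S u → T (adj G u w) → WalkIn G S w v → WalkIn G S u v

InducedConnected : ∀ {n} → Graph n → VSet n → Set
InducedConnected G S = ∀ u v → S u → S v → WalkIn G S u v

Connected : ∀ {n} → Graph n → Set
Connected G = InducedConnected G (λ _ → ⊤')
  where
  open import Data.Unit using () renaming (⊤ to ⊤')

Subcubic : ∀ {n} → Graph n → Set
Subcubic G = Connected G × (∀ v → degree G v ≤ 3)

Dominating : ∀ {n} → Graph n → VSet n → Set
Dominating G D = ∀ v → ¬ D v → ∃[ u ] (D u × T (adj G v u))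

ConnectedDominating : ∀ {n} → Graph n → VSet n → Set
ConnectedDominating G D = Dominating G D × InducedConnected G D

ConnCoalition : ∀ {n} → Graph n → VSet n → VSet n → Set
ConnCoalition G A B =
  (∀ v → A v → ¬ B v) ×
  ¬ ConnectedDominating G A × ¬ ConnectedDominating G B ×
  ConnectedDominating G (A ∪ B)

-- A partition of Fin n into k nonempty classes V_0..V_{k-1}, given by the
-- class map part : Fin n → Fin k (surjective = every class nonempty).
Class : ∀ {n k} → (Fin n → Fin k) → Fin k → VSet n
Class part i v = part v ≡ i

IsPartition : ∀ {n k} → (Fin n → Fin k) → Set
IsPartition part = ∀ i → ∃[ v ] part v ≡ i

SingletonCDS : ∀ {n} → Graph n → VSet n → Set
SingletonCDS G V = ConnectedDominating G V × ∃[ x ] (∀ v → V v → v ≡ x)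

IsConnCoalitionPartition : ∀ {n k} → Graph n → (Fin n → Fin k) → Set
IsConnCoalitionPartition G part =
  IsPartition part ×
  (∀ i → SingletonCDS G (Class part i)
         ⊎ ∃[ j ] ConnCoalition G (Class part i) (Class part j))

CCGAdj : ∀ {n k} → Graph n → (Fin n → Fin k) → Fin k → Fin k → Set
CCGAdj G part i j = ConnCoalition G (Class part i) (Class part j)

CCGDegreeAtLeast4 : ∀ {n k} → Graph n → (Fin n → Fin k) → Fin k → Set
CCGDegreeAtLeast4 {k = k} G part i =
  Σ (Fin 4 → Fin k) λ f → Injective _≡_ _≡_ f × (∀ a → CCGAdj G part i (f a))

{-# OPTIONS --safe #-}
-- Let V be one of the classes with coalition partners W₁, …, W₄, and suppose a vertex
-- x ∉ V has no neighbour in V. Each V ∪ Wₐ is a connected dominating set and V is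
-- nonempty, so x has a neighbour in V ∪ Wₐ (by domination if x ∉ Wₐ, along a walk in
-- G[V ∪ Wₐ] from x to V otherwise), hence in Wₐ. The Wₐ are disjoint, so x would have
-- degree at least 4. Thus V dominates, and since V ∪ W₁ is a coalition V is not a
-- connected dominating set, so G[V] is disconnected.
module Submission where

open import Defs
open import Data.Nat using (ℕ; suc; _≤_; _<_; s≤s)
open import Data.Nat.Properties using (<⇒≱)
open import Data.Fin using (Fin; zero; _≟_)
open import Data.Fin.Properties using (any?; injective⇒≤)
open import Data.Bool using (Bool; true; false; if_then_else_; T)
open import Data.List using (List; []; _∷_; map; allFin; length; filterᵇ)
open import Data.List.Membership.Propositional using (_∈_)
open import Data.List.Membership.Propositional.Properties using (∈-filter⁺; ∈-allFin)
open import Data.Nat.ListAction using (sum)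
open import Data.Product using (_×_; _,_; ∃-syntax; proj₁; proj₂)
open import Data.Sum using (inj₁; inj₂)
open import Data.Empty using (⊥-elim)
open import Relation.Nullary using (¬_; Dec; yes; no)
open import Relation.Nullary.Decidable using (_×-dec_; _⊎-dec_; T?)
open import Relation.Binary.PropositionalEquality using (_≡_; _≢_; refl; trans; cong; subst; setoid)
  renaming (sym to ≡-sym)
open import Function using (_∘_)
open import Function.Definitions using (Injective)
import Data.List.Membership.Setoid.Properties as SetoidMembership

private
  variable
    A : Set
    m n k : ℕ

NeighbourIn : Graph n → VSet n → Fin n → Set
NeighbourIn G D x = ∃[ u ] (D u × T (adj G x u))

sum-indicator≡length-filterᵇ : (p : A → Bool) (xs : List A) →
  sum (map (λ u → if p u then 1 else 0) xs) ≡ length (filterᵇ p xs)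
sum-indicator≡length-filterᵇ p [] = refl
sum-indicator≡length-filterᵇ p (x ∷ xs) with p x
... | true  = cong suc (sum-indicator≡length-filterᵇ p xs)
... | false = sum-indicator≡length-filterᵇ p xs

distinct-members⇒≤length : {xs : List A} (w : Fin m → A) →
  Injective _≡_ _≡_ w → (∀ a → w a ∈ xs) → m ≤ length xs
distinct-members⇒≤length w w-inj w∈xs = injective⇒≤ λ {a} {b} eq →
  w-inj (SetoidMembership.index-injective (setoid _) (w∈xs a) (w∈xs b) eq)

distinct-neighbours⇒≤degree : (G : Graph n) (x : Fin n) (w : Fin m → Fin n) →
  Injective _≡_ _≡_ w → (∀ a → T (adj G x (w a))) → m ≤ degree G x
distinct-neighbours⇒≤degree {n} G x w w-inj x~w =
  subst (_ ≤_) (≡-sym (sum-indicator≡length-filterᵇ (adj G x) (allFin n)))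
    (distinct-members⇒≤length w w-inj λ a →
      ∈-filter⁺ {P = T ∘ adj G x} (T? ∘ adj G x) (∈-allFin (w a)) (x~w a))

walk-start∈ : {G : Graph n} {S : VSet n} {u v : Fin n} → WalkIn G S u v → S u
walk-start∈ (here u∈S)     = u∈S
walk-start∈ (step u∈S _ _) = u∈S

nontrivial-walk⇒neighbour : {G : Graph n} {S : VSet n} {u v : Fin n} →
  WalkIn G S u v → u ≢ v → NeighbourIn G S u
nontrivial-walk⇒neighbour (here _)         u≢u = ⊥-elim (u≢u refl)
nontrivial-walk⇒neighbour (step _ u~w walk) _   = _ , walk-start∈ walk , u~w

connectedDominating⇒neighbour : (G : Graph n) {D : VSet n} {x y : Fin n} →
  ConnectedDominating G D → Dec (D x) → D y → x ≢ y → NeighbourIn G D x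
connectedDominating⇒neighbour G (_ , connected) (yes x∈D) y∈D x≢y =
  nontrivial-walk⇒neighbour (connected _ _ x∈D y∈D) x≢y
connectedDominating⇒neighbour G (dominating , _) (no x∉D) _ _ =
  dominating _ x∉D

coalition-partner-neighbour : (G : Graph n) (part : Fin n → Fin k) →
  IsPartition part → {i j : Fin k} → CCGAdj G part i j → {x : Fin n} →
  ¬ Class part i x → ¬ NeighbourIn G (Class part i) x → NeighbourIn G (Class part j) x
coalition-partner-neighbour G part nonempty {i} {j} (_ , _ , _ , union-cds) {x} x∉Vᵢ x≁Vᵢ
  with y , y∈Vᵢ ← nonempty i
  with connectedDominating⇒neighbour G union-cds ((part x ≟ i) ⊎-dec (part x ≟ j)) (inj₁ y∈Vᵢ)
         (λ { refl → x∉Vᵢ y∈Vᵢ })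
... | u , inj₁ u∈Vᵢ , x~u = ⊥-elim (x≁Vᵢ (u , u∈Vᵢ , x~u))
... | u , inj₂ u∈Vⱼ , x~u = u , u∈Vⱼ , x~u

module _ (G : Graph n) (part : Fin n → Fin k) (nonempty : IsPartition part)
         {i : Fin k} (partner : Fin m → Fin k) (partner-injective : Injective _≡_ _≡_ partner)
         (coalition : ∀ a → CCGAdj G part i (partner a)) where

  undominated⇒partners≤degree : {x : Fin n} → ¬ Class part i x →
    ¬ NeighbourIn G (Class part i) x → m ≤ degree G x
  undominated⇒partners≤degree {x} x∉Vᵢ x≁Vᵢ =
    distinct-neighbours⇒≤degree G x neighbour neighbour-injective (proj₂ ∘ in-partner)
    where
    partner-neighbour : ∀ a → NeighbourIn G (Class part (partner a)) x
    partner-neighbour a = coalition-partner-neighbour G part nonempty (coalition a) x∉Vᵢ x≁Vᵢ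

    neighbour : Fin m → Fin n
    neighbour = proj₁ ∘ partner-neighbour

    in-partner : ∀ a → Class part (partner a) (neighbour a) × T (adj G x (neighbour a))
    in-partner = proj₂ ∘ partner-neighbour

    neighbour-injective : Injective _≡_ _≡_ neighbour
    neighbour-injective {a} {b} eq = partner-injective
      (trans (≡-sym (proj₁ (in-partner a))) (trans (cong part eq) (proj₁ (in-partner b))))

  partners⇒dominating : (∀ v → degree G v < m) → Dominating G (Class part i)
  partners⇒dominating low-degree x x∉Vᵢ
    with any? (λ u → (part u ≟ i) ×-dec T? (adj G x u))
  ... | yes x~Vᵢ = x~Vᵢ
  ... | no  x≁Vᵢ = ⊥-elim (<⇒≱ (low-degree x) (undominated⇒partners≤degree x∉Vᵢ x≁Vᵢ))

lemma4 : ∀ {n k} (G : Graph n) (part : Fin n → Fin k) →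
         Subcubic G → IsConnCoalitionPartition G part →
         (i : Fin k) → CCGDegreeAtLeast4 G part i →
         Dominating G (Class part i) × ¬ InducedConnected G (Class part i)
lemma4 G part (_ , max-degree≤3) (nonempty , _) i (partner , partner-injective , coalition) =
  dominating , λ connected → proj₁ (proj₂ (coalition zero)) (dominating , connected)
  where
  dominating : Dominating G (Class part i)
  dominating = partners⇒dominating G part nonempty partner partner-injective coalition
                 (λ v → s≤s (max-degree≤3 v))
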